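{- Let $U$ be a nonempty set and $\mathcal{D}$ a sublattice of the lattice $(\mathrm{Part}(U);\le)$ of all partitions of $U$. Then the following are equivalent: (a) for all $P_1,P_2,P\in\mathcal{D}$, $P_1\perp P_2\mid P$ holds if and only if $(P_1\vee P)\wedge(P_2\vee P)=P$; (b) any two partitions in $\mathcal{D}$ commute.
   Context: Partitions of $U$ are ordered by $P\le Q$ ($Q$ finer) iff every block of $Q$ lies in a block of $P$. In this order $\mathrm{Part}(U)$ is a lattice: the join $P\vee Q$ has as blocks the nonempty intersections of blocks of $P$ and $Q$; the meet $P\wedge Q$ is the finest partition coarser than both, i.e. the partition whose equivalence relation is the transitive closure of the union of the equivalence relations of $P$ and $Q$. A sublattice is a subfamily closed under these joins and meets. The saturation operator is $\sigma_P(S)=\{u\in U:\exists u'\in S,\ u,u'\text{ in the same block of }P\}$. Partitions $P_1,P_2$ commute if $\sigma_{P_1}\circ\sigma_{P_2}=\sigma_{P_2}\circ\sigma_{P_1}$. For partitions $P_1,P_2,P$, $P_1\perp P_2\mid P$ means: for every block $B$ of $P$, block $B_1$ of $P_1$ and block $B_2$ of $P_2$ with $B_1\cap B\ne\emptyset\ne B_2\cap B$, we have $B_1\cap B_2\cap B\ne\emptyset$. -}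

module Defs where

open import Level using (Level; _⊔_; suc)
open import Data.Product using (Σ; ∃; ∃-syntax; _×_; _,_; proj₁; proj₂)
open import Data.Sum using (_⊎_; inj₁; inj₂)
open import Relation.Unary using (Pred; _∈_)
open import Relation.Binary using (Rel; IsEquivalence)
open import Relation.Binary.Construct.Closure.Transitive as TC using (TransClosure; [_]; _∷_)

-- A partition of U, represented by its equivalence relation "in the same block".
-- The blocks are the equivalence classes.
record Partition {a : Level} (U : Set a) : Set (suc a) where
  field
    _∼_   : Rel U a
    isEqv : IsEquivalence _∼_
  open IsEquivalence isEqv public

open Partition public

module _ {a : Level} {U : Set a} where

  Block : Partition U → U → Pred U a
  Block P u v = _∼_ P u v

  _≐_ : Partition U → Partition U → Set a
  P ≐ Q = ∀ x y → (_∼_ P x y → _∼_ Q x y) × (_∼_ Q x y → _∼_ P x y)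

  -- P ≤ Q  iff  Q is finer than P (every block of Q lies in a block of P)
  _≤ₚ_ : Partition U → Partition U → Set a
  P ≤ₚ Q = ∀ x y → _∼_ Q x y → _∼_ P x y

  _∨ₚ_ : Partition U → Partition U → Partition U
  P ∨ₚ Q = record
    { _∼_ = λ x y → _∼_ P x y × _∼_ Q x y
    ; isEqv = record
      { refl  = Partition.refl P , Partition.refl Q
      ; sym   = λ (p , q) → Partition.sym P p , Partition.sym Q q
      ; trans = λ (p , q) (p' , q') → Partition.trans P p p' , Partition.trans Q q q'
      }
    }

  private
    Un : Partition U → Partition U → Rel U a
    Un P Q x y = _∼_ P x y ⊎ _∼_ Q x y

    symUn : ∀ P Q {x y} → Un P Q x y → Un P Q y x
    symUn P Q (inj₁ p) = inj₁ (Partition.sym P p)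
    symUn P Q (inj₂ q) = inj₂ (Partition.sym Q q)

  _∧ₚ_ : Partition U → Partition U → Partition U
  P ∧ₚ Q = record
    { _∼_ = TransClosure (Un P Q)
    ; isEqv = record
      { refl  = [ inj₁ (Partition.refl P) ]
      ; sym   = TC.symmetric (Un P Q) (symUn P Q)
      ; trans = TC.transitive (Un P Q)
      }
    }

  σ : Partition U → Pred U a → Pred U a
  σ P S u = ∃[ u' ] (S u' × _∼_ P u u')

  _≗ₛ_ : Pred U a → Pred U a → Set a
  S ≗ₛ T = ∀ u → (S u → T u) × (T u → S u)

  Commute : Partition U → Partition U → Set (suc a)
  Commute P₁ P₂ = ∀ (S : Pred U a) → σ P₁ (σ P₂ S) ≗ₛ σ P₂ (σ P₁ S)

  -- P₁ ⊥ P₂ | P : for all blocks B of P, B₁ of P₁, B₂ of P₂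
  -- with B₁ ∩ B ≠ ∅ ≠ B₂ ∩ B, we have B₁ ∩ B₂ ∩ B ≠ ∅
  -- (blocks are given by representatives u, u₁, u₂).
  CondIndep : Partition U → Partition U → Partition U → Set a
  CondIndep P₁ P₂ P = ∀ (u u₁ u₂ : U) →
    (∃[ v ] (Block P₁ u₁ v × Block P u v)) →
    (∃[ v ] (Block P₂ u₂ v × Block P u v)) →
    ∃[ w ] (Block P₁ u₁ w × Block P₂ u₂ w × Block P u w)

  record IsSublattice {b : Level} (D : Partition U → Set b) : Set (suc a ⊔ b) where
    field
      respects : ∀ {P Q} → P ≐ Q → D P → D Q
      ∨-closed : ∀ {P Q} → D P → D Q → D (P ∨ₚ Q)
      ∧-closed : ∀ {P Q} → D P → D Q → D (P ∧ₚ Q)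

-- For equivalence relations, commuting means R ; S = S ; R, and then the composite
-- R ; S is already the meet R ∧ S.  (b ⇒ a): P₁ ⊥ P₂ ∣ P always forces
-- (P₁ ∨ P) ∧ (P₂ ∨ P) = P; conversely, if that meet is P, two P-equivalent points
-- v₁, v₂ are linked by a single step of (P₁ ∨ P) ; (P₂ ∨ P), and its middle point
-- witnesses P₁ ⊥ P₂ ∣ P.  (a ⇒ b): for M = P₁ ∧ P₂ the identity
-- (P₁ ∨ M) ∧ (P₂ ∨ M) = M always holds, so (a) gives P₁ ⊥ P₂ ∣ M, and applying this
-- independence to a path x P₁ y P₂ z yields a point w with x P₂ w P₁ z.
module Submission where

open import Defs
open import Level using (Level; _⊔_; suc)
open import Data.Product using (_×_; _,_; proj₂)
open import Data.Sum using (inj₁; inj₂; [_,_]′)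
open import Relation.Binary using (Rel; Transitive; _⇒_)
open import Relation.Binary.PropositionalEquality as ≡ using (_≡_)
open import Relation.Binary.Construct.Closure.Transitive using (TransClosure; [_]; _∷_)
-- The library's relational composition _;_ is spelt with U+037E, not an ASCII semicolon.
open import Relation.Binary.Construct.Composition as Composition using (_;_)

transClosure-least : ∀ {a ℓ ℓ′} {A : Set a} {R : Rel A ℓ} {T : Rel A ℓ′} →
  Transitive T → R ⇒ T → TransClosure R ⇒ T
transClosure-least trans R⇒T [ r ]    = R⇒T r
transClosure-least trans R⇒T (r ∷ rs) = trans (R⇒T r) (transClosure-least trans R⇒T rs)

module _ {a : Level} {U : Set a} where

  ≤ₚ-antisym : ∀ {P Q : Partition U} → P ≤ₚ Q → Q ≤ₚ P → P ≐ Q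
  ≤ₚ-antisym P≤Q Q≤P x y = Q≤P x y , P≤Q x y

  ∨ₚ-upperʳ : ∀ (P Q : Partition U) → Q ≤ₚ (P ∨ₚ Q)
  ∨ₚ-upperʳ P Q x y = proj₂

  ∨ₚ-absorb : ∀ {P Q : Partition U} → Q ≤ₚ P → (P ∨ₚ Q) ≤ₚ P
  ∨ₚ-absorb Q≤P x y p = p , Q≤P x y p

  ∧ₚ-lowerˡ : ∀ (P Q : Partition U) → (P ∧ₚ Q) ≤ₚ P
  ∧ₚ-lowerˡ P Q x y p = [ inj₁ p ]

  ∧ₚ-lowerʳ : ∀ (P Q : Partition U) → (P ∧ₚ Q) ≤ₚ Q
  ∧ₚ-lowerʳ P Q x y q = [ inj₂ q ]

  ∧ₚ-greatest : ∀ {P Q R : Partition U} → R ≤ₚ P → R ≤ₚ Q → R ≤ₚ (P ∧ₚ Q)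
  ∧ₚ-greatest {R = R} R≤P R≤Q x y =
    transClosure-least (trans R) [ R≤P _ _ , R≤Q _ _ ]′

  ∧ₚ-mono : ∀ {P P′ Q Q′ : Partition U} → P′ ≤ₚ P → Q′ ≤ₚ Q → (P′ ∧ₚ Q′) ≤ₚ (P ∧ₚ Q)
  ∧ₚ-mono {P′ = P′} {Q′ = Q′} P′≤P Q′≤Q x y =
    transClosure-least (trans (P′ ∧ₚ Q′))
      [ (λ p → [ inj₁ (P′≤P _ _ p) ]) , (λ q → [ inj₂ (Q′≤Q _ _ q) ]) ]′

  ≤ₚ-meet-of-joins : ∀ (P₁ P₂ P : Partition U) → P ≤ₚ ((P₁ ∨ₚ P) ∧ₚ (P₂ ∨ₚ P))
  ≤ₚ-meet-of-joins P₁ P₂ P =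
    ∧ₚ-greatest {P₁ ∨ₚ P} {P₂ ∨ₚ P} {P} (∨ₚ-upperʳ P₁ P) (∨ₚ-upperʳ P₂ P)

  meet-of-joins-with-meet : ∀ (P₁ P₂ : Partition U) →
    ((P₁ ∨ₚ (P₁ ∧ₚ P₂)) ∧ₚ (P₂ ∨ₚ (P₁ ∧ₚ P₂))) ≐ (P₁ ∧ₚ P₂)
  meet-of-joins-with-meet P₁ P₂ =
    ≤ₚ-antisym {(P₁ ∨ₚ M) ∧ₚ (P₂ ∨ₚ M)} {M}
      (∧ₚ-mono {P₁} {P₁ ∨ₚ M} {P₂} {P₂ ∨ₚ M}
        (∨ₚ-absorb {P₁} {M} (∧ₚ-lowerˡ P₁ P₂)) (∨ₚ-absorb {P₂} {M} (∧ₚ-lowerʳ P₁ P₂)))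
      (≤ₚ-meet-of-joins P₁ P₂ M)
    where M = P₁ ∧ₚ P₂

  -- Apply Commute to the singleton {z}.
  Commute⇒;-swap : ∀ (R S : Partition U) → Commute R S →
    (_∼_ S ; _∼_ R) ⇒ (_∼_ R ; _∼_ S)
  Commute⇒;-swap R S comm {x} {z} (y , sxy , ryz)
    with proj₂ (comm (_≡ z) x) (y , (z , ≡.refl , ryz) , sxy)
  ... | m , (_ , ≡.refl , smz) , rxm = m , rxm , smz

  ;-swap⇒Commute : ∀ (R S : Partition U) →
    (_∼_ R ; _∼_ S) ⇒ (_∼_ S ; _∼_ R) → Commute R S
  ;-swap⇒Commute R S swap T u = RS⇒SR , SR⇒RS
    where
      RS⇒SR : σ R (σ S T) u → σ S (σ R T) u
      RS⇒SR (m , (t , Tt , smt) , rum) with swap (m , rum , smt)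
      ... | n , sun , rnt = n , (t , Tt , rnt) , sun

      SR⇒RS : σ S (σ R T) u → σ R (σ S T) u
      SR⇒RS (m , (t , Tt , rmt) , sum)
        with swap (m , sym R rmt , sym S sum)
      ... | n , stn , rnu = n , (t , Tt , sym S stn) , sym R rnu

  Commute⇒∧ₚ⊆; : ∀ (R S : Partition U) → Commute R S → _∼_ (R ∧ₚ S) ⇒ (_∼_ R ; _∼_ S)
  Commute⇒∧ₚ⊆; R S comm =
    transClosure-least
      (Composition.transitive (_∼_ R) (_∼_ S) (Commute⇒;-swap R S comm)
        (trans R) (trans S))
      [ (λ r → _ , r , refl S) , (λ s → _ , refl R , s) ]′

  CondIndep⇒meet-of-joins≐ : ∀ (P₁ P₂ P : Partition U) →
    CondIndep P₁ P₂ P → ((P₁ ∨ₚ P) ∧ₚ (P₂ ∨ₚ P)) ≐ P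
  CondIndep⇒meet-of-joins≐ P₁ P₂ P indep =
    ≤ₚ-antisym {(P₁ ∨ₚ P) ∧ₚ (P₂ ∨ₚ P)} {P} meet-of-joins≤P (≤ₚ-meet-of-joins P₁ P₂ P)
    where
      meet-of-joins≤P : ((P₁ ∨ₚ P) ∧ₚ (P₂ ∨ₚ P)) ≤ₚ P
      meet-of-joins≤P x y pxy
        with indep x x y (x , refl P₁ , refl P) (y , refl P₂ , pxy)
      ... | w , p₁xw , p₂yw , pxw =
        inj₁ (p₁xw , pxw) ∷ [ inj₂ (sym P₂ p₂yw , trans P (sym P pxw) pxy) ]

  meet-of-joins≐⇒CondIndep : ∀ (P₁ P₂ P : Partition U) → Commute (P₁ ∨ₚ P) (P₂ ∨ₚ P) →
    ((P₁ ∨ₚ P) ∧ₚ (P₂ ∨ₚ P)) ≐ P → CondIndep P₁ P₂ P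
  meet-of-joins≐⇒CondIndep P₁ P₂ P comm meet≐P u u₁ u₂
                           (v₁ , p₁u₁v₁ , puv₁) (v₂ , p₂u₂v₂ , puv₂)
    with Commute⇒∧ₚ⊆; (P₁ ∨ₚ P) (P₂ ∨ₚ P) comm
           (proj₂ (meet≐P v₁ v₂) (trans P (sym P puv₁) puv₂))
  ... | w , (p₁v₁w , pv₁w) , (p₂wv₂ , _) =
    w , trans P₁ p₁u₁v₁ p₁v₁w
      , trans P₂ p₂u₂v₂ (sym P₂ p₂wv₂)
      , trans P puv₁ pv₁w

  CondIndep-meet⇒Commute : ∀ (P₁ P₂ : Partition U) →
    CondIndep P₁ P₂ (P₁ ∧ₚ P₂) → Commute P₁ P₂
  CondIndep-meet⇒Commute P₁ P₂ indep = ;-swap⇒Commute P₁ P₂ swap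
    where
      swap : (_∼_ P₁ ; _∼_ P₂) ⇒ (_∼_ P₂ ; _∼_ P₁)
      swap {x} {z} (y , p₁xy , p₂yz)
        with indep x z x (z , refl P₁ , inj₁ p₁xy ∷ [ inj₂ p₂yz ])
                         (x , refl P₂ , refl (P₁ ∧ₚ P₂))
      ... | w , p₁zw , p₂xw , _ = w , p₂xw , sym P₁ p₁zw

  module _ {b : Level} (D : Partition U → Set b) where

    CondIndepCharacterised : Set (suc a ⊔ b)
    CondIndepCharacterised = ∀ P₁ P₂ P → D P₁ → D P₂ → D P →
      (CondIndep P₁ P₂ P → ((P₁ ∨ₚ P) ∧ₚ (P₂ ∨ₚ P)) ≐ P)
      × (((P₁ ∨ₚ P) ∧ₚ (P₂ ∨ₚ P)) ≐ P → CondIndep P₁ P₂ P)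

    PairwiseCommuting : Set (suc a ⊔ b)
    PairwiseCommuting = ∀ P₁ P₂ → D P₁ → D P₂ → Commute P₁ P₂

    CondIndepCharacterised⇒PairwiseCommuting : (∀ {P Q} → D P → D Q → D (P ∧ₚ Q)) →
      CondIndepCharacterised → PairwiseCommuting
    CondIndepCharacterised⇒PairwiseCommuting ∧-closed characterised P₁ P₂ d₁ d₂ =
      CondIndep-meet⇒Commute P₁ P₂
        (proj₂ (characterised P₁ P₂ (P₁ ∧ₚ P₂) d₁ d₂ (∧-closed d₁ d₂))
               (meet-of-joins-with-meet P₁ P₂))

    PairwiseCommuting⇒CondIndepCharacterised : (∀ {P Q} → D P → D Q → D (P ∨ₚ Q)) →
      PairwiseCommuting → CondIndepCharacterised
    PairwiseCommuting⇒CondIndepCharacterised ∨-closed commuting P₁ P₂ P d₁ d₂ d =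
      CondIndep⇒meet-of-joins≐ P₁ P₂ P ,
      meet-of-joins≐⇒CondIndep P₁ P₂ P
        (commuting (P₁ ∨ₚ P) (P₂ ∨ₚ P) (∨-closed d₁ d) (∨-closed d₂ d))

-- U need not be nonempty.
mainTheorem7 : {a b : Level} (U : Set a) (u₀ : U)
    (D : Partition U → Set b) → IsSublattice D →
    ((∀ P₁ P₂ P → D P₁ → D P₂ → D P →
        (CondIndep P₁ P₂ P → ((P₁ ∨ₚ P) ∧ₚ (P₂ ∨ₚ P)) ≐ P)
        × (((P₁ ∨ₚ P) ∧ₚ (P₂ ∨ₚ P)) ≐ P → CondIndep P₁ P₂ P))
      → (∀ P₁ P₂ → D P₁ → D P₂ → Commute P₁ P₂))
    × ((∀ P₁ P₂ → D P₁ → D P₂ → Commute P₁ P₂)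
      → (∀ P₁ P₂ P → D P₁ → D P₂ → D P →
        (CondIndep P₁ P₂ P → ((P₁ ∨ₚ P) ∧ₚ (P₂ ∨ₚ P)) ≐ P)
        × (((P₁ ∨ₚ P) ∧ₚ (P₂ ∨ₚ P)) ≐ P → CondIndep P₁ P₂ P)))
mainTheorem7 U _ D sublattice =
  CondIndepCharacterised⇒PairwiseCommuting D ∧-closed ,
  PairwiseCommuting⇒CondIndepCharacterised D ∨-closed
  where open IsSublattice sublattice
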